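{- Let $G$ be a factorizable graph and $X$ an odd-maximal barrier of $G$. Let $D_1,\ldots,D_k$ be the DM-components of $G_X$ and, for each $i$, let $\hat D_i$ be the expansion of $D_i$. Then: (i) $\{V(\hat D_i)\}_{i=1}^k$ is a partition of $X\cup D_X$; (ii) each $V(\hat D_i)$ is separating, and hence $\hat D_i$ is factorizable; (iii) $X\cap V(\hat D_i)$ is an odd-maximal barrier of $\hat D_i$; and (iv) $(\hat D_i)_{X\cap V(\hat D_i)}$ is isomorphic to $D_i$, for each $i=1,\ldots,k$.
   Context: All graphs are finite. A graph is factorizable if it has a perfect matching. For factorizable $G$: an edge is allowed if it lies in some perfect matching; for each connected component $C$ of the subgraph formed by allowed edges, $G[V(C)]$ is a factor-component. $X\subseteq V(G)$ is separating if each factor-component $H$ has $V(H)\subseteq X$ or $V(H)\cap X=\emptyset$. Barriers: $q_G(X)$ = number of odd components of $G-X$; $X$ is a barrier if $q_G(X)-|X|=|V(G)|-2\nu(G)$ ($\nu$ = maximum matching size). $D_X$ = vertices of odd components of $G-X$, $C_X=V(G)\setminus X\setminus D_X$. A barrier $X$ is odd-maximal if no nonempty $Y\subseteq D_X$ makes $X\cup Y$ a barrier. For a graph $G$ and $X\subseteq V(G)$ with odd components $K_1,\ldots,K_l$ of $G-X$, $G_X:=(G-C_X-E(G[X]))/V(K_1)/\cdots/V(K_l)$: delete $C_X$, delete edges with both ends in $X$, contract each $K_i$ to one vertex. For a bipartite factorizable graph, its DM-components are its factor-components. The expansion of a DM-component $D$ of $G_X$ is the subgraph of $G$ induced by $(V(D)\cap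 X)\cup\bigcup V(K_i)$, the union over the odd components $K_i$ whose contracted vertex lies in $D$. -}

module Defs where

open import Data.Nat using (ℕ; zero; suc; _+_; _≤_; _<ᵇ_)
open import Data.Bool using (Bool; true; false; _∧_; _∨_; not; if_then_else_)
open import Data.Fin using (Fin; toℕ; _≟_)
import Data.Fin as F
open import Data.Product using (Σ; _×_; _,_)
open import Data.Sum using (_⊎_)
open import Data.Empty using (⊥)
open import Relation.Nullary using (¬_)
open import Relation.Nullary.Decidable using (⌊_⌋)
open import Relation.Binary.PropositionalEquality using (_≡_)
open import Function.Bundles using (_⇔_)

VSet : ℕ → Set
VSet n = Fin n → Bool

count : ∀ {n} → VSet n → ℕ
count {zero}  S = 0
count {suc n} S = (if S F.zero then 1 else 0) + count (λ v → S (F.suc v))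

anyV : ∀ {n} → VSet n → Bool
anyV {zero}  S = false
anyV {suc n} S = S F.zero ∨ anyV (λ v → S (F.suc v))

_⊆_ : ∀ {n} → VSet n → VSet n → Set
S ⊆ T = ∀ v → S v ≡ true → T v ≡ true

Disjoint : ∀ {n} → VSet n → VSet n → Set
Disjoint S T = ∀ v → S v ≡ true → T v ≡ true → ⊥

NonEmpty : ∀ {n} → VSet n → Set
NonEmpty S = Σ _ λ v → S v ≡ true

isOdd : ℕ → Bool
isOdd zero    = false
isOdd (suc k) = not (isOdd k)

-- Finite graphs: vertex set V ⊆ Fin n, adjacency relation adj.
-- Only adjacency between vertices of V is meaningful.

record Graph : Set where
  field
    n   : ℕ
    V   : VSet n
    adj : Fin n → Fin n → Bool
open Graph public

SimpleGraph : Graph → Set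
SimpleGraph G = (∀ u v → adj G u v ≡ adj G v u) × (∀ v → adj G v v ≡ false)

E : (G : Graph) → Fin (n G) → Fin (n G) → Bool
E G u v = V G u ∧ V G v ∧ adj G u v

_[_] : (G : Graph) → VSet (n G) → Graph
G [ S ] = record { n = n G ; V = λ v → V G v ∧ S v ; adj = adj G }

record IsMatching (G : Graph) (M : Fin (n G) → Fin (n G) → Bool) : Set where
  field
    inE   : ∀ u v → M u v ≡ true → E G u v ≡ true
    symm  : ∀ u v → M u v ≡ true → M v u ≡ true
    deg≤1 : ∀ u v w → M u v ≡ true → M u w ≡ true → v ≡ w

-- number of vertices covered by M (= 2 |M|)
covered : (G : Graph) → (Fin (n G) → Fin (n G) → Bool) → ℕ
covered G M = count (λ v → V G v ∧ anyV (M v))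

PerfectMatching : Graph → Set
PerfectMatching G =
  Σ (Fin (n G) → Fin (n G) → Bool) λ M →
    IsMatching G M × (∀ v → V G v ≡ true → Σ (Fin (n G)) λ u → M v u ≡ true)

Factorizable : Graph → Set
Factorizable G = PerfectMatching G

-- Deficiency G d  :⇔  d = |V(G)| - 2 ν(G)
Deficiency : Graph → ℕ → Set
Deficiency G d =
  (Σ (Fin (n G) → Fin (n G) → Bool) λ M → IsMatching G M × (covered G M + d ≡ count (V G)))
  × (∀ M → IsMatching G M → covered G M + d ≤ count (V G))

Allowed : (G : Graph) → Fin (n G) → Fin (n G) → Set
Allowed G u v = Σ (PerfectMatching G) λ pm → Data.Product.proj₁ pm u v ≡ true
  where import Data.Product

data AReach (G : Graph) (u : Fin (n G)) : Fin (n G) → Set where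
  here : V G u ≡ true → AReach G u u
  step : ∀ {w v} → AReach G u w → Allowed G w v → AReach G u v

IsFactorComponent : (G : Graph) → VSet (n G) → Set
IsFactorComponent G S =
  Σ (Fin (n G)) λ u → V G u ≡ true × (∀ v → (S v ≡ true) ⇔ AReach G u v)

Separating : (G : Graph) → VSet (n G) → Set
Separating G X = ∀ H → IsFactorComponent G H → (H ⊆ X) ⊎ Disjoint H X

reachIn : ℕ → (G : Graph) → VSet (n G) → Fin (n G) → Fin (n G) → Bool
reachIn zero    G T u v = T u ∧ ⌊ u ≟ v ⌋
reachIn (suc k) G T u v =
  reachIn k G T u v ∨ anyV (λ w → reachIn k G T u w ∧ T v ∧ adj G w v)

conn : (G : Graph) → VSet (n G) → Fin (n G) → Fin (n G) → Bool
conn G T = reachIn (n G) G T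

comp : (G : Graph) → VSet (n G) → Fin (n G) → VSet (n G)
comp G T u = conn G T u

minus : (G : Graph) → VSet (n G) → VSet (n G)
minus G X v = V G v ∧ not (X v)

-- r is the representative (least vertex) of an odd component of G - X
oddRep : (G : Graph) → VSet (n G) → VSet (n G)
oddRep G X r =
  minus G X r
  ∧ not (anyV (λ w → conn G (minus G X) r w ∧ (toℕ w <ᵇ toℕ r)))
  ∧ isOdd (count (comp G (minus G X) r))

q : (G : Graph) → VSet (n G) → ℕ
q G X = count (oddRep G X)

DX : (G : Graph) → VSet (n G) → VSet (n G)
DX G X v = minus G X v ∧ anyV (λ r → oddRep G X r ∧ conn G (minus G X) r v)

CX : (G : Graph) → VSet (n G) → VSet (n G)
CX G X v = minus G X v ∧ not (DX G X v)

IsBarrier : (G : Graph) → VSet (n G) → Set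
IsBarrier G X = X ⊆ V G × Σ ℕ λ d → Deficiency G d × (q G X ≡ count X + d)

OddMaximalBarrier : (G : Graph) → VSet (n G) → Set
OddMaximalBarrier G X =
  IsBarrier G X
  × (∀ Y → Y ⊆ DX G X → NonEmpty Y → ¬ IsBarrier G (λ v → X v ∨ Y v))

-- Its vertices are X together with one vertex per odd
-- component K_i of G - X; the contracted vertex of K_i is represented by
-- the representative (least vertex) of K_i.

contractAdj : (G : Graph) → VSet (n G) → Fin (n G) → Fin (n G) → Bool
contractAdj G X u r =
  V G u ∧ X u ∧ oddRep G X r ∧ anyV (λ w → conn G (minus G X) r w ∧ adj G u w)

Contract : (G : Graph) → VSet (n G) → Graph
Contract G X = record
  { n   = n G
  ; V   = λ v → (V G v ∧ X v) ∨ oddRep G X v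
  ; adj = λ u v → contractAdj G X u v ∨ contractAdj G X v u
  }

Expansion : (G : Graph) → (X : VSet (n G)) → VSet (n G) → VSet (n G)
Expansion G X S v =
  (S v ∧ X v) ∨ anyV (λ r → S r ∧ oddRep G X r ∧ conn G (minus G X) r v)

-- DM-components of the (bipartite) graph G_X are its factor-components
IsDMComponent : (G : Graph) → VSet (n G) → Set
IsDMComponent G S = IsFactorComponent G S

record Iso (G H : Graph) : Set where
  field
    to      : Fin (n G) → Fin (n H)
    from    : Fin (n H) → Fin (n G)
    to-V    : ∀ v → V G v ≡ true → V H (to v) ≡ true
    from-V  : ∀ v → V H v ≡ true → V G (from v) ≡ true
    from-to : ∀ v → V G v ≡ true → from (to v) ≡ v
    to-from : ∀ v → V H v ≡ true → to (from v) ≡ v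
    adj-pres : ∀ u v → V G u ≡ true → V G v ≡ true → adj G u v ≡ adj H (to u) (to v)

module Submission where

-- A perfect matching M of G forces deficiency 0, so |X| is the number of odd components of G − X.
-- By parity every odd component K has an M-edge leaving it, necessarily into X; as there are only |X|
-- of them, M pairs X with the odd components and induces a perfect matching of G_X. Hence an M-edge at
-- x ∈ X is an allowed edge of G_X, and every other M-edge stays inside an odd component: M never leaves
-- an expansion. As every allowed edge of G lies in some perfect matching, allowed edges never leave an
-- expansion D̂, which gives (ii) and a perfect matching of D̂. Inside D̂ the odd components of D̂ − X are
-- exactly the odd components of G − X contracted into D, so (iv) holds literally and X ∩ V(D̂) is a
-- barrier by the same pairing. A strictly larger barrier of D̂ would, together with the odd components
-- of G − X outside D̂, which it does not touch, give a strictly larger barrier of G than X.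

open import Defs
open import Data.Bool using (Bool; true; false; _∧_; _∨_; not; if_then_else_)
import Data.Bool as B
open import Data.Bool.Properties using (T-≡; T-not-≡; not-involutive; ∧-identityʳ; ∧-zeroʳ)
open import Data.Empty using (⊥; ⊥-elim)
open import Data.Fin using (Fin; toℕ; _≟_; combine; remQuot)
import Data.Fin as F
import Data.Fin.Properties as FP
open import Data.Fin.Subset using (Subset)
open import Data.Fin.Subset.Properties using (anySubset?)
open import Data.Nat using (ℕ; zero; suc; _+_; _∸_; _*_; _≤_; _<_; _≮_; z≤n; s≤s; _<ᵇ_)
import Data.Nat.Properties as NP
open import Algebra.Properties.CommutativeSemigroup NP.+-commutativeSemigroup using (xy∙z≈xz∙y)
open import Data.Product using (Σ; _×_; _,_; proj₁; proj₂; uncurry)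
open import Data.Sum using (_⊎_; inj₁; inj₂; [_,_]′)
open import Data.Vec using (lookup; tabulate)
open import Data.Vec.Properties using (lookup∘tabulate)
open import Function.Base using (_∘_)
open import Function.Bundles using (Equivalence; mk⇔)
open import Relation.Binary using (tri<; tri≈; tri>)
open import Relation.Binary.PropositionalEquality hiding ([_])
open import Relation.Nullary using (¬_; Dec; yes; no)
open import Relation.Nullary.Decidable using (⌊_⌋; map′; _×-dec_; _→-dec_; toWitness; fromWitness; fromWitnessFalse)

∧-true⁻ˡ : ∀ {a b} → a ∧ b ≡ true → a ≡ true
∧-true⁻ˡ {true} _ = refl

∧-true⁻ʳ : ∀ {a b} → a ∧ b ≡ true → b ≡ true
∧-true⁻ʳ {true} e = e

∧-true⁺ : ∀ {a b} → a ≡ true → b ≡ true → a ∧ b ≡ true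
∧-true⁺ refl refl = refl

true-or-false : ∀ b → b ≡ true ⊎ b ≡ false
true-or-false true  = inj₁ refl
true-or-false false = inj₂ refl

∨-true⁻ : ∀ {a b} → a ∨ b ≡ true → a ≡ true ⊎ b ≡ true
∨-true⁻ {true}  _ = inj₁ refl
∨-true⁻ {false} e = inj₂ e

∨-true⁺ˡ : ∀ {a b} → a ≡ true → a ∨ b ≡ true
∨-true⁺ˡ refl = refl

∨-true⁺ʳ : ∀ {a b} → b ≡ true → a ∨ b ≡ true
∨-true⁺ʳ {true}  _ = refl
∨-true⁺ʳ {false} e = e

not-true⁻ : ∀ {a} → not a ≡ true → a ≡ false
not-true⁻ {false} _ = refl

not-true⁺ : ∀ {a} → a ≡ false → not a ≡ true
not-true⁺ refl = refl

true≢false : ∀ {a} → a ≡ true → a ≡ false → ⊥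
true≢false refl ()

¬true⇒false : ∀ {a} → ¬ (a ≡ true) → a ≡ false
¬true⇒false {true}  h = ⊥-elim (h refl)
¬true⇒false {false} _ = refl

≡-from-true⇔ : ∀ {a b} → (a ≡ true → b ≡ true) → (b ≡ true → a ≡ true) → a ≡ b
≡-from-true⇔ {true}          f _ = sym (f refl)
≡-from-true⇔ {false} {true}  _ g = g refl
≡-from-true⇔ {false} {false} _ _ = refl

∧-not-false⁻ : ∀ {a b} → a ≡ true → a ∧ not b ≡ false → b ≡ true
∧-not-false⁻ {true} {true} _ _ = refl

∧-trueʳ : ∀ {a b} → b ≡ true → a ∧ b ≡ a
∧-trueʳ {a} refl = ∧-identityʳ a

∧-cong-true : ∀ {a b c} → (a ≡ true → b ≡ c) → a ∧ b ≡ a ∧ c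
∧-cong-true {true}  b≡c = b≡c refl
∧-cong-true {false} _   = refl

∧-not-cong-false : ∀ {a b e} → (e ≡ false → a ≡ b) → a ∧ not e ≡ b ∧ not e
∧-not-cong-false {a} {b} {true}  _   = trans (∧-zeroʳ a) (sym (∧-zeroʳ b))
∧-not-cong-false {e = false} a≡b = cong (_∧ true) (a≡b refl)

⌊⌋-true⁻ : ∀ {A : Set} {a? : Dec A} → ⌊ a? ⌋ ≡ true → A
⌊⌋-true⁻ e = toWitness (Equivalence.from T-≡ e)

⌊⌋-true⁺ : ∀ {A : Set} {a? : Dec A} → A → ⌊ a? ⌋ ≡ true
⌊⌋-true⁺ a = Equivalence.to T-≡ (fromWitness a)

⌊⌋-false⁺ : ∀ {A : Set} {a? : Dec A} → ¬ A → ⌊ a? ⌋ ≡ false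
⌊⌋-false⁺ ¬a = Equivalence.to T-not-≡ (fromWitnessFalse ¬a)

anyV⁺ : ∀ {n} (S : VSet n) v → S v ≡ true → anyV S ≡ true
anyV⁺ S F.zero    e = ∨-true⁺ˡ e
anyV⁺ S (F.suc v) e = ∨-true⁺ʳ {S F.zero} (anyV⁺ (S ∘ F.suc) v e)

anyV⁻ : ∀ {n} (S : VSet n) → anyV S ≡ true → Σ (Fin n) λ v → S v ≡ true
anyV⁻ {suc n} S e with ∨-true⁻ {S F.zero} e
... | inj₁ e₀ = F.zero , e₀
... | inj₂ e₁ with anyV⁻ (S ∘ F.suc) e₁
...   | v , Sv = F.suc v , Sv

anyV-false⁻ : ∀ {n} (S : VSet n) → anyV S ≡ false → ∀ v → S v ≡ false
anyV-false⁻ S e v = ¬true⇒false (λ Sv → true≢false (anyV⁺ S v Sv) e)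

anyV-cong : ∀ {n} {S T : VSet n} → (∀ v → S v ≡ T v) → anyV S ≡ anyV T
anyV-cong {S = S} {T} S≗T = ≡-from-true⇔
  (λ e → let (v , Sv) = anyV⁻ S e in anyV⁺ T v (trans (sym (S≗T v)) Sv))
  (λ e → let (v , Tv) = anyV⁻ T e in anyV⁺ S v (trans (S≗T v) Tv))

count-cong : ∀ {n} {S T : VSet n} → (∀ v → S v ≡ T v) → count S ≡ count T
count-cong {zero}  S≗T = refl
count-cong {suc n} S≗T =
  cong₂ _+_ (cong (λ b → if b then 1 else 0) (S≗T F.zero)) (count-cong (S≗T ∘ F.suc))

count-mono : ∀ {n} (S T : VSet n) → S ⊆ T → count S ≤ count T
count-mono {zero}  S T S⊆T = z≤n
count-mono {suc n} S T S⊆T with S F.zero in S₀ | T F.zero in T₀ | count-mono (S ∘ F.suc) (T ∘ F.suc) (S⊆T ∘ F.suc)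
... | true  | true  | rest = s≤s rest
... | true  | false | _    = ⊥-elim (true≢false (S⊆T F.zero S₀) T₀)
... | false | true  | rest = NP.m≤n⇒m≤1+n rest
... | false | false | rest = rest

count-split : ∀ {n} (S P : VSet n) →
  count S ≡ count (λ v → S v ∧ P v) + count (λ v → S v ∧ not (P v))
count-split {zero}  S P = refl
count-split {suc n} S P with S F.zero | P F.zero | count-split (S ∘ F.suc) (P ∘ F.suc)
... | true  | true  | rest = cong suc rest
... | true  | false | rest = trans (cong suc rest) (sym (NP.+-suc _ _))
... | false | true  | rest = rest
... | false | false | rest = rest

count-∪ : ∀ {n} (A B : VSet n) → Disjoint A B → count (λ v → A v ∨ B v) ≡ count A + count B
count-∪ A B disjoint = trans (count-split _ A) (cong₂ _+_ (count-cong ∪∩A) (count-cong ∪∖A))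
  where
  ∪∩A : ∀ v → ((A v ∨ B v) ∧ A v) ≡ A v
  ∪∩A v with A v
  ... | true  = refl
  ... | false = ∧-zeroʳ (B v)
  ∪∖A : ∀ v → ((A v ∨ B v) ∧ not (A v)) ≡ B v
  ∪∖A v with A v in Av | B v in Bv
  ... | true  | true  = ⊥-elim (disjoint v Av Bv)
  ... | true  | false = refl
  ... | false | b     = ∧-identityʳ b

count-empty : ∀ {n} (S : VSet n) → (∀ v → S v ≡ false) → count S ≡ 0
count-empty {zero}  S S≡∅ = refl
count-empty {suc n} S S≡∅ rewrite S≡∅ F.zero = count-empty (S ∘ F.suc) (S≡∅ ∘ F.suc)

count-singleton : ∀ {n} (a : Fin n) → count (λ v → ⌊ v ≟ a ⌋) ≡ 1
count-singleton {suc n} F.zero =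
  cong suc (count-empty {n} (λ v → ⌊ F.suc v ≟ F.zero ⌋) (λ v → refl))
count-singleton {suc n} (F.suc a) = trans (count-cong suc≟suc) (count-singleton a)
  where
  suc≟suc : ∀ v → ⌊ F.suc v ≟ F.suc a ⌋ ≡ ⌊ v ≟ a ⌋
  suc≟suc v = ≡-from-true⇔ (λ e → ⌊⌋-true⁺ (FP.suc-injective (⌊⌋-true⁻ e)))
                           (λ e → ⌊⌋-true⁺ (cong F.suc (⌊⌋-true⁻ e)))

remove : ∀ {n} → VSet n → Fin n → VSet n
remove S a v = S v ∧ not ⌊ v ≟ a ⌋

remove⁺ : ∀ {n} (S : VSet n) {a v} → S v ≡ true → v ≢ a → remove S a v ≡ true
remove⁺ S Sv v≢a = ∧-true⁺ Sv (not-true⁺ (⌊⌋-false⁺ v≢a))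

remove⁻ : ∀ {n} (S : VSet n) {a v} → remove S a v ≡ true → S v ≡ true
remove⁻ S = ∧-true⁻ˡ

remove-≢ : ∀ {n} (S : VSet n) {a v} → remove S a v ≡ true → v ≢ a
remove-≢ S {v = v} e refl = true≢false (⌊⌋-true⁺ refl) (not-true⁻ (∧-true⁻ʳ {S v} e))

count-remove : ∀ {n} (S : VSet n) a → S a ≡ true → count S ≡ suc (count (remove S a))
count-remove S a Sa = trans (count-split S (λ v → ⌊ v ≟ a ⌋))
  (cong (_+ count (remove S a)) (trans (count-cong S∩a≡a) (count-singleton a)))
  where
  S∩a≡a : ∀ v → (S v ∧ ⌊ v ≟ a ⌋) ≡ ⌊ v ≟ a ⌋
  S∩a≡a v with v ≟ a
  ... | yes refl rewrite Sa = refl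
  ... | no _ with S v
  ...   | true  = refl
  ...   | false = refl

count-nonempty : ∀ {n} (S : VSet n) → 0 < count S → Σ (Fin n) λ v → S v ≡ true
count-nonempty {suc n} S pos with S F.zero in e
... | true  = F.zero , e
... | false with count-nonempty (S ∘ F.suc) pos
...   | v , Sv = F.suc v , Sv

count-≤-size : ∀ {n} (S : VSet n) → count S ≤ n
count-≤-size {zero}  S = z≤n
count-≤-size {suc n} S with S F.zero
... | true  = s≤s (count-≤-size (S ∘ F.suc))
... | false = NP.m≤n⇒m≤1+n (count-≤-size (S ∘ F.suc))

count-< : ∀ {n} (S S′ : VSet n) a → S ⊆ S′ → S′ a ≡ true → S a ≡ false → count S < count S′
count-< S S′ a S⊆S′ S′a Sa rewrite count-remove S′ a S′a =
  s≤s (count-mono S (remove S′ a) (λ v Sv → remove⁺ S′ (S⊆S′ v Sv) λ { refl → true≢false Sv Sa }))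

MapsTo : ∀ {n} → VSet n → VSet n → (Fin n → Fin n) → Set
MapsTo S T f = ∀ a → S a ≡ true → T (f a) ≡ true

InjectiveOn : ∀ {n} → VSet n → (Fin n → Fin n) → Set
InjectiveOn S f = ∀ a b → S a ≡ true → S b ≡ true → f a ≡ f b → a ≡ b

count-≤-injection : ∀ {n} {S T : VSet n} (f : Fin n → Fin n) →
  MapsTo S T f → InjectiveOn S f → count S ≤ count T
count-≤-injection f = go _ refl
  where
  go : ∀ k {S T} → count S ≡ k → MapsTo S T f → InjectiveOn S f → count S ≤ count T
  go zero    e _ _ rewrite e = z≤n
  go (suc k) {S} {T} e maps inj with count-nonempty S (subst (0 <_) (sym e) (s≤s z≤n))
  ... | a , Sa = subst₂ _≤_ (sym (count-remove S a Sa)) (sym (count-remove T (f a) (maps a Sa)))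
    (s≤s (go k (NP.suc-injective (trans (sym (count-remove S a Sa)) e)) maps′ inj′))
    where
    maps′ : MapsTo (remove S a) (remove T (f a)) f
    maps′ b h = remove⁺ T (maps b (remove⁻ S h)) (λ fb≡fa → remove-≢ S h (inj b a (remove⁻ S h) Sa fb≡fa))
    inj′ : InjectiveOn (remove S a) f
    inj′ b c hb hc = inj b c (remove⁻ S hb) (remove⁻ S hc)

injection-surjective : ∀ {n} {S T : VSet n} (f : Fin n → Fin n) → count T ≤ count S →
  MapsTo S T f → InjectiveOn S f → ∀ b → T b ≡ true → Σ (Fin n) λ a → S a ≡ true × f a ≡ b
injection-surjective {S = S} {T} f T≤S maps inj b Tb with anyV (λ a → S a ∧ ⌊ f a ≟ b ⌋) in e
... | true  = let (a , h) = anyV⁻ _ e in a , ∧-true⁻ˡ h , ⌊⌋-true⁻ (∧-true⁻ʳ {S a} h)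
... | false = ⊥-elim (NP.<-irrefl refl (NP.≤-trans (subst (_≤ count S) (count-remove T b Tb) T≤S)
                                              (count-≤-injection f missesB inj)))
  where
  missesB : MapsTo S (remove T b) f
  missesB a Sa = remove⁺ T (maps a Sa) λ fa≡b →
    true≢false (∧-true⁺ Sa (⌊⌋-true⁺ fa≡b)) (anyV-false⁻ _ e a)

FixedPointFreeInvolutionOn : ∀ {n} → VSet n → (Fin n → Fin n) → Set
FixedPointFreeInvolutionOn S p =
  MapsTo S S p × (∀ a → S a ≡ true → p (p a) ≡ a) × (∀ a → S a ≡ true → p a ≢ a)

removePair : ∀ {n} → VSet n → (Fin n → Fin n) → Fin n → VSet n
removePair S p a = remove (remove S a) (p a)

module _ {n} {S : VSet n} {p : Fin n → Fin n} (involution : FixedPointFreeInvolutionOn S p)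
         {a : Fin n} (Sa : S a ≡ true) where
  private
    S₁ : VSet n
    S₁ = remove S a
    closed : MapsTo S S p
    closed = proj₁ involution
    involutive : ∀ b → S b ≡ true → p (p b) ≡ b
    involutive = proj₁ (proj₂ involution)
    fixedPointFree : ∀ b → S b ≡ true → p b ≢ b
    fixedPointFree = proj₂ (proj₂ involution)

  count-removePair : count S ≡ suc (suc (count (removePair S p a)))
  count-removePair = trans (count-remove S a Sa)
    (cong suc (count-remove S₁ (p a) (remove⁺ S (closed a Sa) (fixedPointFree a Sa))))

  removePair-involution : FixedPointFreeInvolutionOn (removePair S p a) p
  removePair-involution = closed′ , (λ b h → involutive b (⊆S h)) , (λ b h → fixedPointFree b (⊆S h))
    where
    ⊆S : ∀ {b} → removePair S p a b ≡ true → S b ≡ true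
    ⊆S h = remove⁻ S (remove⁻ S₁ h)
    closed′ : MapsTo (removePair S p a) (removePair S p a) p
    closed′ b h = remove⁺ S₁ (remove⁺ S (closed b (⊆S h)) pb≢a) pb≢pa
      where
      pb≢a : p b ≢ a
      pb≢a pb≡a = remove-≢ S₁ h (trans (sym (involutive b (⊆S h))) (cong p pb≡a))
      pb≢pa : p b ≢ p a
      pb≢pa pb≡pa = remove-≢ S (remove⁻ S₁ h)
        (trans (sym (involutive b (⊆S h))) (trans (cong p pb≡pa) (involutive a Sa)))

count-even-by-involution : ∀ {n} {S : VSet n} (p : Fin n → Fin n) →
  FixedPointFreeInvolutionOn S p → isOdd (count S) ≡ false
count-even-by-involution p = go _ refl
  where
  go : ∀ k {S} → count S ≡ k → FixedPointFreeInvolutionOn S p → isOdd (count S) ≡ false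
  go zero e _ rewrite e = refl
  go (suc k) {S} e involution with count-nonempty S (subst (0 <_) (sym e) (s≤s z≤n))
  ... | a , Sa = begin
    isOdd (count S)                  ≡⟨ cong isOdd count-S ⟩
    not (not (isOdd (count S′)))     ≡⟨ not-involutive _ ⟩
    isOdd (count S′)                 ≡⟨ go′ k (NP.suc-injective (trans (sym count-S) e)) ⟩
    false                            ∎
    where
    open ≡-Reasoning
    S′ : VSet _
    S′ = removePair S p a
    count-S : count S ≡ suc (suc (count S′))
    count-S = count-removePair involution Sa
    go′ : ∀ k → suc (count S′) ≡ k → isOdd (count S′) ≡ false
    go′ (suc j) e′ = go j (NP.suc-injective e′) (removePair-involution involution Sa)

module Walks (G : Graph) (T : VSet (n G)) where

  lastStep : ℕ → Fin (n G) → Fin (n G) → VSet (n G)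
  lastStep k u v w = reachIn k G T u w ∧ T v ∧ adj G w v

  reachIn-source : ∀ k {u v} → reachIn k G T u v ≡ true → T u ≡ true
  reachIn-source zero    e = ∧-true⁻ˡ e
  reachIn-source (suc k) {u} {v} e with ∨-true⁻ {reachIn k G T u v} e
  ... | inj₁ e′ = reachIn-source k e′
  ... | inj₂ e′ = reachIn-source k (∧-true⁻ˡ (proj₂ (anyV⁻ (lastStep k u v) e′)))

  reachIn-target : ∀ k {u v} → reachIn k G T u v ≡ true → T v ≡ true
  reachIn-target zero    {u} e = subst (λ z → T z ≡ true) (⌊⌋-true⁻ (∧-true⁻ʳ {T u} e)) (∧-true⁻ˡ e)
  reachIn-target (suc k) {u} {v} e with ∨-true⁻ {reachIn k G T u v} e
  ... | inj₁ e′ = reachIn-target k e′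
  ... | inj₂ e′ = let (w , h) = anyV⁻ (lastStep k u v) e′ in ∧-true⁻ˡ (∧-true⁻ʳ {reachIn k G T u w} h)

  reachIn-refl : ∀ {u} → T u ≡ true → reachIn 0 G T u u ≡ true
  reachIn-refl Tu = ∧-true⁺ Tu (⌊⌋-true⁺ refl)

  reachIn-snoc : ∀ k {u w v} → reachIn k G T u w ≡ true → T v ≡ true → adj G w v ≡ true →
    reachIn (suc k) G T u v ≡ true
  reachIn-snoc k {u} {w} {v} e Tv wv =
    ∨-true⁺ʳ {reachIn k G T u v} (anyV⁺ (lastStep k u v) w (∧-true⁺ e (∧-true⁺ Tv wv)))

  reachIn-suc⁻ : ∀ k {u v} → reachIn (suc k) G T u v ≡ true →
    reachIn k G T u v ≡ true
    ⊎ Σ (Fin (n G)) λ w → reachIn k G T u w ≡ true × T v ≡ true × adj G w v ≡ true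
  reachIn-suc⁻ k {u} {v} e with ∨-true⁻ {reachIn k G T u v} e
  ... | inj₁ e′ = inj₁ e′
  ... | inj₂ e′ = let (w , h) = anyV⁻ (lastStep k u v) e′ ; h′ = ∧-true⁻ʳ {reachIn k G T u w} h in
    inj₂ (w , ∧-true⁻ˡ h , ∧-true⁻ˡ h′ , ∧-true⁻ʳ {T v} h′)

  reachIn-weaken : ∀ {k k′} → k ≤ k′ → ∀ {u v} → reachIn k G T u v ≡ true → reachIn k′ G T u v ≡ true
  reachIn-weaken {k} {k′} k≤k′ {u} {v} e =
    subst (λ m → reachIn m G T u v ≡ true) (NP.m∸n+n≡m k≤k′) (pad (k′ ∸ k))
    where
    pad : ∀ j → reachIn (j + k) G T u v ≡ true
    pad zero    = e
    pad (suc j) = ∨-true⁺ˡ (pad j)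

  reachIn-++ : ∀ j {k u w v} → reachIn k G T u w ≡ true → reachIn j G T w v ≡ true →
    reachIn (j + k) G T u v ≡ true
  reachIn-++ zero {k} {u} {w} e₁ e₂ = subst (λ z → reachIn k G T u z ≡ true) (⌊⌋-true⁻ (∧-true⁻ʳ {T w} e₂)) e₁
  reachIn-++ (suc j) {k} e₁ e₂ with reachIn-suc⁻ j e₂
  ... | inj₁ e₂′               = ∨-true⁺ˡ (reachIn-++ j e₁ e₂′)
  ... | inj₂ (z , e₂′ , Tv , zv) = reachIn-snoc (j + k) (reachIn-++ j e₁ e₂′) Tv zv

  -- The balls around u grow strictly until they stabilise, so they stabilise within n G steps.
  module Saturation (u : Fin (n G)) where
    ball : ℕ → VSet (n G)
    ball k = reachIn k G T u

    ball-step-mono : ∀ k k′ → ball k ⊆ ball k′ → ball (suc k) ⊆ ball (suc k′)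
    ball-step-mono k k′ sub v e with reachIn-suc⁻ k e
    ... | inj₁ e′                 = ∨-true⁺ˡ (sub v e′)
    ... | inj₂ (w , e′ , Tv , wv) = reachIn-snoc k′ (sub w e′) Tv wv

    Stable : ℕ → Set
    Stable j = ball (suc j) ⊆ ball j

    stable-forever : ∀ j → Stable j → ∀ i → ball (i + j) ⊆ ball j
    stable-forever j st zero    v e = e
    stable-forever j st (suc i) v e = st v (ball-step-mono (i + j) j (stable-forever j st i) v e)

    stable-or-large : T u ≡ true → ∀ m → (Σ ℕ λ j → j ≤ m × Stable j) ⊎ (m < count (ball m))
    stable-or-large Tu zero = inj₂ (subst (0 <_) (sym (count-remove (ball 0) u (reachIn-refl Tu))) (s≤s z≤n))
    stable-or-large Tu (suc m) with stable-or-large Tu m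
    ... | inj₁ (j , j≤m , st) = inj₁ (j , NP.m≤n⇒m≤1+n j≤m , st)
    ... | inj₂ large with anyV (λ v → ball (suc m) v ∧ not (ball m v)) in e
    ...   | true  = let (a , h) = anyV⁻ (λ v → ball (suc m) v ∧ not (ball m v)) e in
      inj₂ (NP.≤-trans (s≤s large)
        (count-< (ball m) (ball (suc m)) a (λ v → ∨-true⁺ˡ) (∧-true⁻ˡ h)
                 (not-true⁻ (∧-true⁻ʳ {ball (suc m) a} h))))
    ...   | false = inj₁ (m , NP.m≤n⇒m≤1+n NP.≤-refl ,
      λ v h → ∧-not-false⁻ h (anyV-false⁻ (λ v → ball (suc m) v ∧ not (ball m v)) e v))

    saturate : ∀ k → ball k ⊆ ball (n G)
    saturate k v e with T u in Tu
    ... | false = ⊥-elim (true≢false (reachIn-source k e) Tu)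
    ... | true with stable-or-large Tu (n G)
    ...   | inj₂ large = ⊥-elim (NP.<-irrefl refl (NP.<-≤-trans large (count-≤-size (ball (n G)))))
    ...   | inj₁ (j , j≤n , st) with NP.≤-total k j
    ...     | inj₁ k≤j = reachIn-weaken j≤n (reachIn-weaken k≤j e)
    ...     | inj₂ j≤k = reachIn-weaken j≤n
                (stable-forever j st (k ∸ j) v (subst (λ m → ball m v ≡ true) (sym (NP.m∸n+n≡m j≤k)) e))

  reachIn⇒conn : ∀ k {u v} → reachIn k G T u v ≡ true → conn G T u v ≡ true
  reachIn⇒conn k {u} {v} = Saturation.saturate u k v

  conn-refl : ∀ {u} → T u ≡ true → conn G T u u ≡ true
  conn-refl Tu = reachIn⇒conn 0 (reachIn-refl Tu)

  conn-trans : ∀ {u w v} → conn G T u w ≡ true → conn G T w v ≡ true → conn G T u v ≡ true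
  conn-trans e₁ e₂ = reachIn⇒conn (n G + n G) (reachIn-++ (n G) {n G} e₁ e₂)

  conn-snoc : ∀ {u w v} → conn G T u w ≡ true → T v ≡ true → adj G w v ≡ true → conn G T u v ≡ true
  conn-snoc e Tv wv = reachIn⇒conn (suc (n G)) (reachIn-snoc (n G) e Tv wv)

  conn-source : ∀ {u v} → conn G T u v ≡ true → T u ≡ true
  conn-source e = reachIn-source (n G) e

  conn-target : ∀ {u v} → conn G T u v ≡ true → T v ≡ true
  conn-target e = reachIn-target (n G) e

  conn-sym : (∀ u v → adj G u v ≡ adj G v u) → ∀ {u v} → conn G T u v ≡ true → conn G T v u ≡ true
  conn-sym adj-sym = reverse (n G)
    where
    reverse : ∀ k {u v} → reachIn k G T u v ≡ true → conn G T v u ≡ true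
    reverse zero {u} e =
      subst (λ z → conn G T z u ≡ true) (⌊⌋-true⁻ (∧-true⁻ʳ {T u} e)) (conn-refl (∧-true⁻ˡ e))
    reverse (suc k) {u} {v} e with reachIn-suc⁻ k e
    ... | inj₁ e′                 = reverse k e′
    ... | inj₂ (w , e′ , Tv , wv) =
      conn-trans (conn-snoc (conn-refl Tv) (reachIn-target k e′) (trans (adj-sym v w) wv)) (reverse k e′)

open Walks public

reachIn-mono : ∀ (G : Graph) {T T′ : VSet (n G)} → T ⊆ T′ →
  ∀ k {u v} → reachIn k G T u v ≡ true → reachIn k G T′ u v ≡ true
reachIn-mono G {T} T⊆T′ zero    e = ∧-true⁺ (T⊆T′ _ (∧-true⁻ˡ e)) (∧-true⁻ʳ {T _} e)
reachIn-mono G {T} {T′} T⊆T′ (suc k) e with reachIn-suc⁻ G T k e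
... | inj₁ e′                 = ∨-true⁺ˡ (reachIn-mono G T⊆T′ k e′)
... | inj₂ (w , e′ , Tv , wv) = reachIn-snoc G T′ k (reachIn-mono G T⊆T′ k e′) (T⊆T′ _ Tv) wv

reachIn-cong : ∀ (G : Graph) {T T′ : VSet (n G)} → (∀ v → T v ≡ T′ v) →
  ∀ k u v → reachIn k G T u v ≡ reachIn k G T′ u v
reachIn-cong G T≗T′ k u v = ≡-from-true⇔
  (reachIn-mono G (λ w e → trans (sym (T≗T′ w)) e) k)
  (reachIn-mono G (λ w e → trans (T≗T′ w) e) k)

reachIn-restrict : ∀ (G : Graph) (T P : VSet (n G)) u → (∀ v → conn G T u v ≡ true → P v ≡ true) →
  ∀ k v → reachIn k G (λ w → T w ∧ P w) u v ≡ reachIn k G T u v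
reachIn-restrict G T P u P⊇comp k v = ≡-from-true⇔ (reachIn-mono G (λ w → ∧-true⁻ˡ) k) (restrict k)
  where
  P⊇reach : ∀ k {v} → reachIn k G T u v ≡ true → P v ≡ true
  P⊇reach k e = P⊇comp _ (reachIn⇒conn G T k e)
  restrict : ∀ k {v} → reachIn k G T u v ≡ true → reachIn k G (λ w → T w ∧ P w) u v ≡ true
  restrict zero e =
    ∧-true⁺ (∧-true⁺ (∧-true⁻ˡ e) (P⊇reach 0 (reachIn-refl G T (∧-true⁻ˡ e)))) (∧-true⁻ʳ {T u} e)
  restrict (suc k) e with reachIn-suc⁻ G T k e
  ... | inj₁ e′                 = ∨-true⁺ˡ (restrict k e′)
  ... | inj₂ (w , e′ , Tv , wv) = reachIn-snoc G _ k (restrict k e′) (∧-true⁺ Tv (P⊇reach (suc k) e)) wv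

reachIn-induced : ∀ (G : Graph) (S T : VSet (n G)) k u v → reachIn k (G [ S ]) T u v ≡ reachIn k G T u v
reachIn-induced G S T zero    u v = refl
reachIn-induced G S T (suc k) u v = cong₂ _∨_ (reachIn-induced G S T k u v)
  (anyV-cong (λ w → cong (_∧ (T v ∧ adj G w v)) (reachIn-induced G S T k u w)))

-- oddRep G X is definitionally oddRepOf (minus G X) (conn G (minus G X)).
oddRepOf : ∀ {n} → VSet n → (Fin n → VSet n) → VSet n
oddRepOf T component r =
  T r ∧ not (anyV (λ w → component r w ∧ (toℕ w <ᵇ toℕ r))) ∧ isOdd (count (component r))

oddRepOf-cong : ∀ {n} (T T′ : VSet n) (c c′ : Fin n → VSet n) r →
  T r ≡ T′ r → (∀ w → c r w ≡ c′ r w) → oddRepOf T c r ≡ oddRepOf T′ c′ r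
oddRepOf-cong T T′ c c′ r Tr≡ c≗c′ = cong₂ _∧_ Tr≡ (cong₂ _∧_
  (cong not (anyV-cong (λ w → cong (_∧ (toℕ w <ᵇ toℕ r)) (c≗c′ w))))
  (cong isOdd (count-cong c≗c′)))

DX⁺ : ∀ (G : Graph) (Z : VSet (n G)) {r v} →
  oddRep G Z r ≡ true → conn G (minus G Z) r v ≡ true → DX G Z v ≡ true
DX⁺ G Z {r} {v} o c = ∧-true⁺ (conn-target G (minus G Z) c)
  (anyV⁺ (λ r → oddRep G Z r ∧ conn G (minus G Z) r v) r (∧-true⁺ o c))

DX⁻ : ∀ (G : Graph) (Z : VSet (n G)) {v} → DX G Z v ≡ true →
  Σ (Fin (n G)) λ r → oddRep G Z r ≡ true × conn G (minus G Z) r v ≡ true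
DX⁻ G Z {v} Dv = let (r , h) = anyV⁻ (λ r → oddRep G Z r ∧ conn G (minus G Z) r v) (∧-true⁻ʳ {minus G Z v} Dv) in
  r , ∧-true⁻ˡ h , ∧-true⁻ʳ {oddRep G Z r} h

E-Vˡ : ∀ (G : Graph) {u v} → E G u v ≡ true → V G u ≡ true
E-Vˡ G = ∧-true⁻ˡ

E-Vʳ : ∀ (G : Graph) {u v} → E G u v ≡ true → V G v ≡ true
E-Vʳ G {u} e = ∧-true⁻ˡ (∧-true⁻ʳ {V G u} e)

E-adj : ∀ (G : Graph) {u v} → E G u v ≡ true → adj G u v ≡ true
E-adj G {u} {v} e = ∧-true⁻ʳ {V G v} (∧-true⁻ʳ {V G u} e)

choose : ∀ {n} → VSet n → Fin n → Fin n
choose S default with FP.any? (λ v → S v B.≟ true)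
... | yes (v , _) = v
... | no _        = default

choose-∈ : ∀ {n} (S : VSet n) default v → S v ≡ true → S (choose S default) ≡ true
choose-∈ S default v Sv with FP.any? (λ v → S v B.≟ true)
... | yes (_ , Su) = Su
... | no none      = ⊥-elim (none (v , Sv))

module Partner (H : Graph) (pm : PerfectMatching H) where
  M : Fin (n H) → Fin (n H) → Bool
  M = proj₁ pm

  isMatching : IsMatching H M
  isMatching = proj₁ (proj₂ pm)

  open IsMatching isMatching

  partner : Fin (n H) → Fin (n H)
  partner v = choose (M v) v

  partner-matched : ∀ v → V H v ≡ true → M v (partner v) ≡ true
  partner-matched v Vv = let (u , Mvu) = proj₂ (proj₂ pm) v Vv in choose-∈ (M v) v u Mvu

  partner-unique : ∀ v u → M v u ≡ true → partner v ≡ u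
  partner-unique v u Mvu = deg≤1 v (partner v) u (choose-∈ (M v) v u Mvu) Mvu

  partner-edge : ∀ v → V H v ≡ true → E H v (partner v) ≡ true
  partner-edge v Vv = inE v (partner v) (partner-matched v Vv)

  partner-V : ∀ v → V H v ≡ true → V H (partner v) ≡ true
  partner-V v Vv = E-Vʳ H (partner-edge v Vv)

  partner-adj : ∀ v → V H v ≡ true → adj H v (partner v) ≡ true
  partner-adj v Vv = E-adj H (partner-edge v Vv)

  partner-involutive : ∀ v → V H v ≡ true → partner (partner v) ≡ v
  partner-involutive v Vv = partner-unique (partner v) v (symm v (partner v) (partner-matched v Vv))

  partner-injective : ∀ a b → V H a ≡ true → V H b ≡ true → partner a ≡ partner b → a ≡ b
  partner-injective a b Va Vb pa≡pb =
    trans (sym (partner-involutive a Va)) (trans (cong partner pa≡pb) (partner-involutive b Vb))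

covered-perfect : ∀ (H : Graph) (pm : PerfectMatching H) → covered H (proj₁ pm) ≡ count (V H)
covered-perfect H pm = count-cong V∧matched≡V
  where
  V∧matched≡V : ∀ v → (V H v ∧ anyV (proj₁ pm v)) ≡ V H v
  V∧matched≡V v with V H v in Vv
  ... | false = refl
  ... | true  = let (u , Mvu) = proj₂ (proj₂ pm) v Vv in anyV⁺ (proj₁ pm v) u Mvu

perfect⇒deficiency-0 : ∀ (H : Graph) → PerfectMatching H → Deficiency H 0
perfect⇒deficiency-0 H pm =
  (proj₁ pm , proj₁ (proj₂ pm) , trans (NP.+-identityʳ _) (covered-perfect H pm)) ,
  λ M _ → subst (_≤ count (V H)) (sym (NP.+-identityʳ _)) (count-mono _ (V H) (λ v → ∧-true⁻ˡ))

perfect⇒deficiency≡0 : ∀ (H : Graph) → PerfectMatching H → ∀ d → Deficiency H d → d ≡ 0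
perfect⇒deficiency≡0 H pm d (_ , maximal) = NP.n≤0⇒n≡0 (NP.+-cancelˡ-≤ (count (V H)) d 0
  (subst₂ _≤_ (cong (_+ d) (covered-perfect H pm)) (sym (NP.+-identityʳ _)) (maximal (proj₁ pm) (proj₁ (proj₂ pm)))))

module FactorComponents (H : Graph) where
  Allowed-sym : ∀ {a b} → Allowed H a b → Allowed H b a
  Allowed-sym (pm , e) = pm , IsMatching.symm (proj₁ (proj₂ pm)) _ _ e

  Allowed-E : ∀ {a b} → Allowed H a b → E H a b ≡ true
  Allowed-E (pm , e) = IsMatching.inE (proj₁ (proj₂ pm)) _ _ e

  Allowed-V : ∀ {a b} → Allowed H a b → V H b ≡ true
  Allowed-V al = E-Vʳ H (Allowed-E al)

  AReach-V : ∀ {u v} → AReach H u v → V H v ≡ true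
  AReach-V (here Vu)   = Vu
  AReach-V (step _ al) = Allowed-V al

  AReach-trans : ∀ {u w v} → AReach H u w → AReach H w v → AReach H u v
  AReach-trans r (here _)     = r
  AReach-trans r (step r′ al) = step (AReach-trans r r′) al

  AReach-sym : ∀ {u v} → AReach H u v → AReach H v u
  AReach-sym (here Vu)   = here Vu
  AReach-sym (step r al) = AReach-trans (step (here (Allowed-V al)) (Allowed-sym al)) (AReach-sym r)

  module _ {S : VSet (n H)} (fc : IsFactorComponent H S) where
    root : Fin (n H)
    root = proj₁ fc

    AReach-root⁺ : ∀ {v} → S v ≡ true → AReach H root v
    AReach-root⁺ {v} = Equivalence.to (proj₂ (proj₂ fc) v)

    AReach-root⁻ : ∀ {v} → AReach H root v → S v ≡ true
    AReach-root⁻ {v} = Equivalence.from (proj₂ (proj₂ fc) v)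

    root-∈ : S root ≡ true
    root-∈ = AReach-root⁻ (here (proj₁ (proj₂ fc)))

    factorComponent-V : ∀ {v} → S v ≡ true → V H v ≡ true
    factorComponent-V Sv = AReach-V (AReach-root⁺ Sv)

    factorComponent-closed : ∀ {a b} → Allowed H a b → S a ≡ S b
    factorComponent-closed al = ≡-from-true⇔
      (λ Sa → AReach-root⁻ (step (AReach-root⁺ Sa) al))
      (λ Sb → AReach-root⁻ (step (AReach-root⁺ Sb) (Allowed-sym al)))

  factorComponent-unique : ∀ {S S′} → IsFactorComponent H S → IsFactorComponent H S′ →
    ∀ {z} → S z ≡ true → S′ z ≡ true → ∀ w → S w ≡ S′ w
  factorComponent-unique fc fc′ Sz S′z w = ≡-from-true⇔
    (λ Sw → AReach-root⁻ fc′ (via fc′ fc S′z Sz Sw))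
    (λ S′w → AReach-root⁻ fc (via fc fc′ Sz S′z S′w))
    where
    via : ∀ {S S′} (fc : IsFactorComponent H S) (fc′ : IsFactorComponent H S′) {z w} →
      S z ≡ true → S′ z ≡ true → S′ w ≡ true → AReach H (root fc) w
    via fc fc′ Sz S′z S′w =
      AReach-trans (AReach-root⁺ fc Sz) (AReach-trans (AReach-sym (AReach-root⁺ fc′ S′z)) (AReach-root⁺ fc′ S′w))

module DecidableAllowed (H : Graph) where
  Relation : Set
  Relation = Fin (n H) → Fin (n H) → Bool

  Covering : Relation → Set
  Covering M = ∀ v → V H v ≡ true → Σ (Fin (n H)) λ u → M v u ≡ true

  PerfectMatchingThrough : Fin (n H) → Fin (n H) → Relation → Set
  PerfectMatchingThrough a b M = (IsMatching H M × Covering M) × M a b ≡ true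

  isMatching? : ∀ M → Dec (IsMatching H M)
  isMatching? M = map′ (λ (inE , symm , deg≤1) → record { inE = inE ; symm = symm ; deg≤1 = deg≤1 })
                       (λ m → IsMatching.inE m , IsMatching.symm m , IsMatching.deg≤1 m)
    (FP.all? (λ u → FP.all? λ v → M u v B.≟ true →-dec E H u v B.≟ true) ×-dec
     FP.all? (λ u → FP.all? λ v → M u v B.≟ true →-dec M v u B.≟ true) ×-dec
     FP.all? (λ u → FP.all? λ v → FP.all? λ w → M u v B.≟ true →-dec (M u w B.≟ true →-dec v ≟ w)))

  perfectMatchingThrough? : ∀ a b M → Dec (PerfectMatchingThrough a b M)
  perfectMatchingThrough? a b M =
    (isMatching? M ×-dec FP.all? (λ v → V H v B.≟ true →-dec FP.any? (λ u → M v u B.≟ true))) ×-dec M a b B.≟ true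

  perfectMatchingThrough-cong : ∀ {a b M M′} → (∀ i j → M i j ≡ M′ i j) →
    PerfectMatchingThrough a b M → PerfectMatchingThrough a b M′
  perfectMatchingThrough-cong {a} {b} {M} {M′} M≗M′ ((m , covering) , Mab) =
    (record { inE   = λ u v e → IsMatching.inE m u v (from e)
            ; symm  = λ u v e → to (IsMatching.symm m u v (from e))
            ; deg≤1 = λ u v w e₁ e₂ → IsMatching.deg≤1 m u v w (from e₁) (from e₂) }
    , λ v Vv → let (u , Mvu) = covering v Vv in u , to Mvu)
    , to Mab
    where
    to : ∀ {i j} → M i j ≡ true → M′ i j ≡ true
    to {i} {j} e = trans (sym (M≗M′ i j)) e
    from : ∀ {i j} → M′ i j ≡ true → M i j ≡ true
    from {i} {j} e = trans (M≗M′ i j) e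

  -- A relation on Fin (n H) is coded as a subset of Fin (n H * n H), which anySubset? can search.
  decode : Subset (n H * n H) → Relation
  decode s i j = lookup s (combine i j)

  encode : Relation → Subset (n H * n H)
  encode M = tabulate (λ k → uncurry M (remQuot (n H) k))

  decode-encode : ∀ M i j → decode (encode M) i j ≡ M i j
  decode-encode M i j = trans (lookup∘tabulate _ (combine i j)) (cong (uncurry M) (FP.remQuot-combine i j))

  allowed? : ∀ a b → Dec (Allowed H a b)
  allowed? a b = map′
    (λ (s , ((m , covering) , e)) → (decode s , m , covering) , e)
    (λ ((M , m , covering) , e) →
      encode M , perfectMatchingThrough-cong (λ i j → sym (decode-encode M i j)) ((m , covering) , e))
    (anySubset? (λ s → perfectMatchingThrough? a b (decode s)))

allowedGraph : Graph → Graph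
allowedGraph H = record { n = n H ; V = V H ; adj = λ a b → ⌊ DecidableAllowed.allowed? H a b ⌋ }

factorComponentOf : (H : Graph) → Fin (n H) → VSet (n H)
factorComponentOf H = conn (allowedGraph H) (V H)

module _ (H : Graph) where
  open FactorComponents H
  open DecidableAllowed H using (allowed?)

  AReach⇒reachIn : ∀ {u v} → AReach H u v → Σ ℕ λ k → reachIn k (allowedGraph H) (V H) u v ≡ true
  AReach⇒reachIn (here Vu)   = 0 , reachIn-refl (allowedGraph H) (V H) Vu
  AReach⇒reachIn (step r al) = let (k , e) = AReach⇒reachIn r in
    suc k , reachIn-snoc (allowedGraph H) (V H) k e (Allowed-V al) (⌊⌋-true⁺ {a? = allowed? _ _} al)

  reachIn⇒AReach : ∀ k {u v} → reachIn k (allowedGraph H) (V H) u v ≡ true → AReach H u v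
  reachIn⇒AReach zero {u} e = subst (AReach H u) (⌊⌋-true⁻ (∧-true⁻ʳ {V H u} e)) (here (∧-true⁻ˡ e))
  reachIn⇒AReach (suc k) e with reachIn-suc⁻ (allowedGraph H) (V H) k e
  ... | inj₁ e′                  = reachIn⇒AReach k e′
  ... | inj₂ (w , e′ , _ , wv) = step (reachIn⇒AReach k e′) (⌊⌋-true⁻ {a? = allowed? w _} wv)

  factorComponentOf-isFactorComponent : ∀ {u} → V H u ≡ true → IsFactorComponent H (factorComponentOf H u)
  factorComponentOf-isFactorComponent {u} Vu = u , Vu , λ v → mk⇔ (reachIn⇒AReach (n H))
    (λ r → let (k , e) = AReach⇒reachIn r in reachIn⇒conn (allowedGraph H) (V H) k e)

perfectMatching-induced : ∀ (H : Graph) (pm : PerfectMatching H) (U : VSet (n H)) →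
  (∀ {a b} → proj₁ pm a b ≡ true → U a ≡ U b) → PerfectMatching (H [ U ])
perfectMatching-induced H (M , m , covering) U M-respects-U =
  M∩U , record { inE = inE ; symm = symm ; deg≤1 = deg≤1 } , covering′
  where
  M∩U : Fin (n H) → Fin (n H) → Bool
  M∩U a b = U a ∧ M a b
  inE : ∀ a b → M∩U a b ≡ true → E (H [ U ]) a b ≡ true
  inE a b e = ∧-true⁺ (∧-true⁺ (E-Vˡ H Eab) Ua)
                      (∧-true⁺ (∧-true⁺ (E-Vʳ H Eab) (trans (sym (M-respects-U Mab)) Ua)) (E-adj H Eab))
    where
    Ua : U a ≡ true
    Ua = ∧-true⁻ˡ e
    Mab : M a b ≡ true
    Mab = ∧-true⁻ʳ {U a} e
    Eab : E H a b ≡ true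
    Eab = IsMatching.inE m a b Mab
  symm : ∀ a b → M∩U a b ≡ true → M∩U b a ≡ true
  symm a b e = let Mab = ∧-true⁻ʳ {U a} e in
    ∧-true⁺ (trans (sym (M-respects-U Mab)) (∧-true⁻ˡ e)) (IsMatching.symm m a b Mab)
  deg≤1 : ∀ a b c → M∩U a b ≡ true → M∩U a c ≡ true → b ≡ c
  deg≤1 a b c e₁ e₂ = IsMatching.deg≤1 m a b c (∧-true⁻ʳ {U a} e₁) (∧-true⁻ʳ {U a} e₂)
  covering′ : ∀ v → V (H [ U ]) v ≡ true → Σ (Fin (n H)) λ u → M∩U v u ≡ true
  covering′ v VUv = let (u , Mvu) = covering v (∧-true⁻ˡ VUv) in u , ∧-true⁺ (∧-true⁻ʳ {V H v} VUv) Mvu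

module BarrierStructure (G : Graph) (simple : SimpleGraph G) (X : VSet (n G)) where

  V∖X : VSet (n G)
  V∖X = minus G X

  _∼_ : Fin (n G) → Fin (n G) → Set
  u ∼ v = conn G V∖X u v ≡ true

  ∼-refl : ∀ {u} → V∖X u ≡ true → u ∼ u
  ∼-refl = conn-refl G V∖X

  ∼-trans : ∀ {u w v} → u ∼ w → w ∼ v → u ∼ v
  ∼-trans = conn-trans G V∖X

  ∼-sym : ∀ {u v} → u ∼ v → v ∼ u
  ∼-sym = conn-sym G V∖X (proj₁ simple)

  ∼-snoc : ∀ {u w v} → u ∼ w → V∖X v ≡ true → adj G w v ≡ true → u ∼ v
  ∼-snoc = conn-snoc G V∖X

  ∼-source : ∀ {u v} → u ∼ v → V∖X u ≡ true
  ∼-source = conn-source G V∖X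

  ∼-target : ∀ {u v} → u ∼ v → V∖X v ≡ true
  ∼-target = conn-target G V∖X

  V∖X-X : ∀ {v} → V∖X v ≡ true → X v ≡ false
  V∖X-X {v} h = not-true⁻ (∧-true⁻ʳ {V G v} h)

  V∖X-V : ∀ {v} → V∖X v ≡ true → V G v ≡ true
  V∖X-V = ∧-true⁻ˡ

  V∖X⁺ : ∀ {v} → V G v ≡ true → X v ≡ false → V∖X v ≡ true
  V∖X⁺ Vv Xv = ∧-true⁺ Vv (not-true⁺ Xv)

  oddRep-V∖X : ∀ {r} → oddRep G X r ≡ true → V∖X r ≡ true
  oddRep-V∖X = ∧-true⁻ˡ

  oddRep-X : ∀ {r} → oddRep G X r ≡ true → X r ≡ false
  oddRep-X o = V∖X-X (oddRep-V∖X o)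

  oddRep-odd : ∀ {r} → oddRep G X r ≡ true → isOdd (count (conn G V∖X r)) ≡ true
  oddRep-odd {r} o = ∧-true⁻ʳ {not (anyV (λ w → conn G V∖X r w ∧ (toℕ w <ᵇ toℕ r)))} (∧-true⁻ʳ {V∖X r} o)

  oddRep-least : ∀ {r w} → oddRep G X r ≡ true → r ∼ w → toℕ w ≮ toℕ r
  oddRep-least {r} {w} o r∼w w<r = true≢false
    (anyV⁺ (λ w → conn G V∖X r w ∧ (toℕ w <ᵇ toℕ r)) w (∧-true⁺ r∼w (Equivalence.to T-≡ (NP.<⇒<ᵇ w<r))))
    (not-true⁻ (∧-true⁻ˡ (∧-true⁻ʳ {V∖X r} o)))

  oddRep-unique : ∀ {r r′ v} → oddRep G X r ≡ true → oddRep G X r′ ≡ true → r ∼ v → r′ ∼ v → r ≡ r′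
  oddRep-unique {r} {r′} o o′ r∼v r′∼v with NP.<-cmp (toℕ r) (toℕ r′)
  ... | tri≈ _ r≡r′ _ = FP.toℕ-injective r≡r′
  ... | tri< r<r′ _ _ = ⊥-elim (oddRep-least o′ (∼-trans r′∼v (∼-sym r∼v)) r<r′)
  ... | tri> _ _ r′<r = ⊥-elim (oddRep-least o (∼-trans r∼v (∼-sym r′∼v)) r′<r)

  module Expansions (S : VSet (n G)) where
    Ex : VSet (n G)
    Ex = Expansion G X S

    expansion-X : ∀ {v} → X v ≡ true → Ex v ≡ S v
    expansion-X {v} Xv = ≡-from-true⇔ fromEx (λ Sv → ∨-true⁺ˡ (∧-true⁺ Sv Xv))
      where
      fromEx : Ex v ≡ true → S v ≡ true
      fromEx e with ∨-true⁻ {S v ∧ X v} e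
      ... | inj₁ e′ = ∧-true⁻ˡ e′
      ... | inj₂ e′ = let (r , h) = anyV⁻ (λ r → S r ∧ oddRep G X r ∧ conn G V∖X r v) e′ in
        ⊥-elim (true≢false Xv (V∖X-X (∼-target (∧-true⁻ʳ {oddRep G X r} (∧-true⁻ʳ {S r} h)))))

    expansion-witness : ∀ {v} → Ex v ≡ true → X v ≡ false →
      Σ (Fin (n G)) λ r → S r ≡ true × oddRep G X r ≡ true × r ∼ v
    expansion-witness {v} e Xv with ∨-true⁻ {S v ∧ X v} e
    ... | inj₁ e′ = ⊥-elim (true≢false (∧-true⁻ʳ {S v} e′) Xv)
    ... | inj₂ e′ = let (r , h) = anyV⁻ (λ r → S r ∧ oddRep G X r ∧ conn G V∖X r v) e′ in
      r , ∧-true⁻ˡ h , ∧-true⁻ˡ (∧-true⁻ʳ {S r} h) , ∧-true⁻ʳ {oddRep G X r} (∧-true⁻ʳ {S r} h)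

    expansion-D : ∀ {r v} → oddRep G X r ≡ true → r ∼ v → Ex v ≡ S r
    expansion-D {r} {v} o r∼v = ≡-from-true⇔
      (λ e → let (r′ , Sr′ , o′ , r′∼v) = expansion-witness e (V∖X-X (∼-target r∼v)) in
             subst (λ z → S z ≡ true) (oddRep-unique o′ o r′∼v r∼v) Sr′)
      (λ Sr → ∨-true⁺ʳ {S v ∧ X v}
        (anyV⁺ (λ r → S r ∧ oddRep G X r ∧ conn G V∖X r v) r (∧-true⁺ Sr (∧-true⁺ o r∼v))))

    expansion-oddRep : ∀ {r} → oddRep G X r ≡ true → Ex r ≡ S r
    expansion-oddRep o = expansion-D o (∼-refl (oddRep-V∖X o))

    expansion-∼ : ∀ {a b} → a ∼ b → Ex a ≡ Ex b
    expansion-∼ {a} {b} a∼b = ≡-from-true⇔ (along a∼b) (along (∼-sym a∼b))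
      where
      along : ∀ {a b} → a ∼ b → Ex a ≡ true → Ex b ≡ true
      along {a} {b} a∼b e = let (r , Sr , o , r∼a) = expansion-witness e (V∖X-X (∼-source a∼b)) in
        trans (expansion-D o (∼-trans r∼a a∼b)) Sr

    Ĝ : Graph
    Ĝ = G [ Ex ]

    -- Z′ plays the role of Z inside Ĝ; typically Z′ = Z ∩ Ex.
    module Induced (Z Z′ : VSet (n G)) (X⊆Z : X ⊆ Z) (Z′≡Z : ∀ v → Ex v ≡ true → Z′ v ≡ Z v) where
      minus-induced : ∀ v → minus Ĝ Z′ v ≡ minus G Z v ∧ Ex v
      minus-induced v with Ex v in Exv
      ... | true  rewrite Z′≡Z v Exv | ∧-identityʳ (V G v) | ∧-identityʳ (V G v ∧ not (Z v)) = refl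
      ... | false rewrite ∧-zeroʳ (V G v) | ∧-zeroʳ (V G v ∧ not (Z v)) = refl

      component-⊆-Ex : ∀ {r v} → Ex r ≡ true → conn G (minus G Z) r v ≡ true → Ex v ≡ true
      component-⊆-Ex Exr e = trans (sym (expansion-∼ (reachIn-mono G minusZ⊆V∖X (n G) e))) Exr
        where
        minusZ⊆V∖X : minus G Z ⊆ V∖X
        minusZ⊆V∖X v h = V∖X⁺ (∧-true⁻ˡ h)
          (¬true⇒false (λ Xv → true≢false (X⊆Z v Xv) (not-true⁻ (∧-true⁻ʳ {V G v} h))))

      conn-induced : ∀ {r} → Ex r ≡ true → ∀ w → conn Ĝ (minus Ĝ Z′) r w ≡ conn G (minus G Z) r w
      conn-induced {r} Exr w = begin
        reachIn (n G) Ĝ (minus Ĝ Z′) r w                    ≡⟨ reachIn-induced G Ex (minus Ĝ Z′) (n G) r w ⟩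
        reachIn (n G) G (minus Ĝ Z′) r w                    ≡⟨ reachIn-cong G minus-induced (n G) r w ⟩
        reachIn (n G) G (λ v → minus G Z v ∧ Ex v) r w
          ≡⟨ reachIn-restrict G (minus G Z) Ex r (λ v → component-⊆-Ex Exr) (n G) w ⟩
        reachIn (n G) G (minus G Z) r w                     ∎
        where open ≡-Reasoning

      oddRep-induced : ∀ {r} → Ex r ≡ true → oddRep Ĝ Z′ r ≡ oddRep G Z r
      oddRep-induced {r} Exr =
        oddRepOf-cong (minus Ĝ Z′) (minus G Z) (conn Ĝ (minus Ĝ Z′)) (conn G (minus G Z)) r
          (trans (minus-induced r) (∧-trueʳ Exr)) (conn-induced Exr)

      oddRep-induced-Ex : ∀ {r} → oddRep Ĝ Z′ r ≡ true → Ex r ≡ true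
      oddRep-induced-Ex {r} o = ∧-true⁻ʳ {V G r} (∧-true⁻ˡ (∧-true⁻ˡ o))

      oddRep-induced-∧ : ∀ r → (oddRep G Z r ∧ Ex r) ≡ oddRep Ĝ Z′ r
      oddRep-induced-∧ r = ≡-from-true⇔
        (λ h → trans (oddRep-induced (∧-true⁻ʳ {oddRep G Z r} h)) (∧-true⁻ˡ h))
        (λ h → ∧-true⁺ (trans (sym (oddRep-induced (oddRep-induced-Ex h))) h) (oddRep-induced-Ex h))

      DX-induced : ∀ {v} → DX Ĝ Z′ v ≡ true → DX G Z v ≡ true
      DX-induced {v} h = let (r , o , c) = DX⁻ Ĝ Z′ h ; Exr = oddRep-induced-Ex o in
        DX⁺ G Z (trans (sym (oddRep-induced Exr)) o) (trans (sym (conn-induced Exr v)) c)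

    oddRep-∪-outside : ∀ (Y : VSet (n G)) → Y ⊆ Ex → ∀ {r} → Ex r ≡ false →
      oddRep G (λ v → X v ∨ Y v) r ≡ oddRep G X r
    oddRep-∪-outside Y Y⊆Ex {r} Exr =
      oddRepOf-cong (minus G (λ v → X v ∨ Y v)) V∖X (conn G (minus G (λ v → X v ∨ Y v))) (conn G V∖X) r
        (trans (minus-∪ r) (∧-trueʳ (not-true⁺ (Y-false Exr))))
        (λ w → trans (reachIn-cong G minus-∪ (n G) r w)
                     (reachIn-restrict G V∖X (λ v → not (Y v)) r avoidsY (n G) w))
      where
      minus-∪ : ∀ v → minus G (λ v → X v ∨ Y v) v ≡ V∖X v ∧ not (Y v)
      minus-∪ v with V G v | X v
      ... | true  | true  = refl
      ... | true  | false = refl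
      ... | false | _     = refl
      Y-false : ∀ {v} → Ex v ≡ false → Y v ≡ false
      Y-false Exv = ¬true⇒false (λ Yv → true≢false (Y⊆Ex _ Yv) Exv)
      avoidsY : ∀ v → r ∼ v → not (Y v) ≡ true
      avoidsY v r∼v = not-true⁺ (Y-false (trans (sym (expansion-∼ r∼v)) Exr))

  GX : Graph
  GX = Contract G X

  GX-V-X : ∀ {a} → V G a ≡ true → X a ≡ true → V GX a ≡ true
  GX-V-X Va Xa = ∨-true⁺ˡ (∧-true⁺ Va Xa)

  GX-V-oddRep : ∀ {r} → oddRep G X r ≡ true → V GX r ≡ true
  GX-V-oddRep {r} o = ∨-true⁺ʳ {V G r ∧ X r} o

  module Matched (qX : q G X ≡ count X) (pm : PerfectMatching G) where
    open Partner G pm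

    partner-≢ : ∀ v → V G v ≡ true → partner v ≢ v
    partner-≢ v Vv pv≡v = true≢false (subst (λ z → adj G v z ≡ true) pv≡v (partner-adj v Vv)) (proj₂ simple v)

    leaving : Fin (n G) → VSet (n G)
    leaving r k = conn G V∖X r k ∧ not (conn G V∖X r (partner k))

    -- An odd component cannot be matched within itself.
    leaving-nonempty : ∀ r → oddRep G X r ≡ true → anyV (leaving r) ≡ true
    leaving-nonempty r o with anyV (leaving r) in none
    ... | true  = refl
    ... | false = ⊥-elim (true≢false (oddRep-odd o) (count-even-by-involution partner
          (closed , (λ a r∼a → partner-involutive a (V∖X-V (∼-target r∼a)))
                  , (λ a r∼a → partner-≢ a (V∖X-V (∼-target r∼a))))))
      where
      closed : MapsTo (conn G V∖X r) (conn G V∖X r) partner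
      closed a r∼a = ∧-not-false⁻ r∼a (anyV-false⁻ (leaving r) none a)

    exit : Fin (n G) → Fin (n G)
    exit r = choose (leaving r) r

    exit-leaving : ∀ r → oddRep G X r ≡ true → leaving r (exit r) ≡ true
    exit-leaving r o = let (k , h) = anyV⁻ (leaving r) (leaving-nonempty r o) in choose-∈ (leaving r) r k h

    exit-∼ : ∀ r → oddRep G X r ≡ true → r ∼ exit r
    exit-∼ r o = ∧-true⁻ˡ (exit-leaving r o)

    mate : Fin (n G) → Fin (n G)
    mate r = partner (exit r)

    mate-X : ∀ r → oddRep G X r ≡ true → X (mate r) ≡ true
    mate-X r o with X (mate r) in Xm
    ... | true  = refl
    ... | false = ⊥-elim (true≢false
        (∼-snoc (exit-∼ r o) (V∖X⁺ (partner-V (exit r) Vk) Xm) (partner-adj (exit r) Vk))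
        (not-true⁻ (∧-true⁻ʳ {conn G V∖X r (exit r)} (exit-leaving r o))))
      where
      Vk : V G (exit r) ≡ true
      Vk = V∖X-V (∼-target (exit-∼ r o))

    mate-V : ∀ r → oddRep G X r ≡ true → V G (mate r) ≡ true
    mate-V r o = partner-V (exit r) (V∖X-V (∼-target (exit-∼ r o)))

    partner-mate : ∀ r → oddRep G X r ≡ true → partner (mate r) ≡ exit r
    partner-mate r o = partner-involutive (exit r) (V∖X-V (∼-target (exit-∼ r o)))

    mate-injective : InjectiveOn (oddRep G X) mate
    mate-injective a b oa ob ma≡mb = oddRep-unique oa ob (exit-∼ a oa)
      (subst (b ∼_) (trans (sym (partner-mate b ob)) (trans (cong partner (sym ma≡mb)) (partner-mate a oa))) (exit-∼ b ob))

    X-matched-into-odd : ∀ x → X x ≡ true →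
      Σ (Fin (n G)) λ r → oddRep G X r ≡ true × r ∼ partner x × mate r ≡ x
    X-matched-into-odd x Xx =
      let (r , o , mr≡x) = injection-surjective mate (subst (count X ≤_) (sym qX) NP.≤-refl) mate-X mate-injective x Xx in
      r , o , subst (r ∼_) (trans (sym (partner-mate r o)) (cong partner mr≡x)) (exit-∼ r o) , mr≡x

    matchedTo : Fin (n G) → Fin (n G) → Bool
    matchedTo x r = X x ∧ V G x ∧ oddRep G X r ∧ conn G V∖X r (partner x)

    record MatchedTo (x r : Fin (n G)) : Set where
      field
        X-x      : X x ≡ true
        V-x      : V G x ≡ true
        oddRep-r : oddRep G X r ≡ true
        r∼px     : r ∼ partner x

    matchedTo⁻ : ∀ {x r} → matchedTo x r ≡ true → MatchedTo x r
    matchedTo⁻ {x} {r} h = record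
      { X-x = ∧-true⁻ˡ h
      ; V-x = ∧-true⁻ˡ (∧-true⁻ʳ {X x} h)
      ; oddRep-r = ∧-true⁻ˡ (∧-true⁻ʳ {V G x} (∧-true⁻ʳ {X x} h))
      ; r∼px = ∧-true⁻ʳ {oddRep G X r} (∧-true⁻ʳ {V G x} (∧-true⁻ʳ {X x} h)) }

    matchedTo⁺ : ∀ {x r} → MatchedTo x r → matchedTo x r ≡ true
    matchedTo⁺ m = ∧-true⁺ X-x (∧-true⁺ V-x (∧-true⁺ oddRep-r r∼px))
      where open MatchedTo m

    matchedTo-mate : ∀ {x r} → matchedTo x r ≡ true → x ≡ mate r
    matchedTo-mate h = let (r′ , o′ , r′∼px , mr′≡x) = X-matched-into-odd _ X-x in
      trans (sym mr′≡x) (cong mate (oddRep-unique o′ oddRep-r r′∼px r∼px))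
      where open MatchedTo (matchedTo⁻ h)

    matchedTo-contractAdj : ∀ {x r} → matchedTo x r ≡ true → contractAdj G X x r ≡ true
    matchedTo-contractAdj {x} {r} h = ∧-true⁺ V-x (∧-true⁺ X-x (∧-true⁺ oddRep-r
      (anyV⁺ (λ w → conn G V∖X r w ∧ adj G x w) (partner x) (∧-true⁺ r∼px (partner-adj x V-x)))))
      where open MatchedTo (matchedTo⁻ h)

    contractedMatching : Fin (n G) → Fin (n G) → Bool
    contractedMatching a b = matchedTo a b ∨ matchedTo b a

    contractedMatching-isMatching : IsMatching GX contractedMatching
    contractedMatching-isMatching = record { inE = inE ; symm = symm ; deg≤1 = deg≤1 }
      where
      inE : ∀ a b → contractedMatching a b ≡ true → E GX a b ≡ true
      inE a b e with ∨-true⁻ {matchedTo a b} e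
      ... | inj₁ h = let open MatchedTo (matchedTo⁻ h) in
        ∧-true⁺ (GX-V-X V-x X-x) (∧-true⁺ (GX-V-oddRep oddRep-r) (∨-true⁺ˡ (matchedTo-contractAdj h)))
      ... | inj₂ h = let open MatchedTo (matchedTo⁻ h) in
        ∧-true⁺ (GX-V-oddRep oddRep-r)
                (∧-true⁺ (GX-V-X V-x X-x) (∨-true⁺ʳ {contractAdj G X a b} (matchedTo-contractAdj h)))
      symm : ∀ a b → contractedMatching a b ≡ true → contractedMatching b a ≡ true
      symm a b e with ∨-true⁻ {matchedTo a b} e
      ... | inj₁ h = ∨-true⁺ʳ {matchedTo b a} h
      ... | inj₂ h = ∨-true⁺ˡ h
      deg≤1 : ∀ a b c → contractedMatching a b ≡ true → contractedMatching a c ≡ true → b ≡ c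
      deg≤1 a b c e₁ e₂ with ∨-true⁻ {matchedTo a b} e₁ | ∨-true⁻ {matchedTo a c} e₂
      ... | inj₁ h₁ | inj₁ h₂ = oddRep-unique (MatchedTo.oddRep-r (matchedTo⁻ h₁)) (MatchedTo.oddRep-r (matchedTo⁻ h₂))
                                              (MatchedTo.r∼px (matchedTo⁻ h₁)) (MatchedTo.r∼px (matchedTo⁻ h₂))
      ... | inj₁ h₁ | inj₂ h₂ = ⊥-elim (true≢false (MatchedTo.X-x (matchedTo⁻ h₁)) (oddRep-X (MatchedTo.oddRep-r (matchedTo⁻ h₂))))
      ... | inj₂ h₁ | inj₁ h₂ = ⊥-elim (true≢false (MatchedTo.X-x (matchedTo⁻ h₂)) (oddRep-X (MatchedTo.oddRep-r (matchedTo⁻ h₁))))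
      ... | inj₂ h₁ | inj₂ h₂ = trans (matchedTo-mate h₁) (sym (matchedTo-mate h₂))

    contractedPerfectMatching : PerfectMatching GX
    contractedPerfectMatching = contractedMatching , contractedMatching-isMatching , covering
      where
      covering : ∀ v → V GX v ≡ true → Σ (Fin (n G)) λ u → contractedMatching v u ≡ true
      covering v Vv with ∨-true⁻ {V G v ∧ X v} Vv
      ... | inj₁ VXv = let (r , o , r∼pv , _) = X-matched-into-odd v (∧-true⁻ʳ {V G v} VXv) in
        r , ∨-true⁺ˡ (matchedTo⁺ (record
          { X-x = ∧-true⁻ʳ {V G v} VXv ; V-x = ∧-true⁻ˡ VXv ; oddRep-r = o ; r∼px = r∼pv }))
      ... | inj₂ o = mate v , ∨-true⁺ʳ {matchedTo v (mate v)} (matchedTo⁺ (record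
        { X-x = mate-X v o ; V-x = mate-V v o ; oddRep-r = o
        ; r∼px = subst (v ∼_) (sym (partner-mate v o)) (exit-∼ v o) }))

    contractedMatching-X→oddRep : ∀ {a b} → X a ≡ true → contractedMatching a b ≡ true → oddRep G X b ≡ true
    contractedMatching-X→oddRep {a} {b} Xa e with ∨-true⁻ {matchedTo a b} e
    ... | inj₁ h = MatchedTo.oddRep-r (matchedTo⁻ h)
    ... | inj₂ h = ⊥-elim (true≢false Xa (oddRep-X (MatchedTo.oddRep-r (matchedTo⁻ h))))

    contractedMatching-oddRep→X : ∀ {a b} → oddRep G X a ≡ true → contractedMatching a b ≡ true → X b ≡ true
    contractedMatching-oddRep→X {a} {b} o e with ∨-true⁻ {matchedTo a b} e
    ... | inj₁ h = ⊥-elim (true≢false (MatchedTo.X-x (matchedTo⁻ h)) (oddRep-X o))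
    ... | inj₂ h = MatchedTo.X-x (matchedTo⁻ h)

    matching-E : ∀ {a b} → M a b ≡ true → E G a b ≡ true
    matching-E {a} {b} = IsMatching.inE isMatching a b

    allowed-via-X : ∀ {x b} → X x ≡ true → M x b ≡ true →
      Σ (Fin (n G)) λ r → oddRep G X r ≡ true × r ∼ b × Allowed GX x r
    allowed-via-X {x} {b} Xx Mxb = let (r , o , r∼px , _) = X-matched-into-odd x Xx in
      r , o , subst (r ∼_) (partner-unique x b Mxb) r∼px ,
      (contractedPerfectMatching , ∨-true⁺ˡ (matchedTo⁺ (record
        { X-x = Xx ; V-x = E-Vˡ G (matching-E Mxb) ; oddRep-r = o ; r∼px = r∼px })))

    module _ {S : VSet (n G)} (fc : IsFactorComponent GX S) where
      open Expansions S

      matching-preserves-expansion : ∀ {a b} → M a b ≡ true → Ex a ≡ Ex b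
      matching-preserves-expansion {a} {b} Mab with true-or-false (X a) | true-or-false (X b)
      ... | inj₁ Xa | _ = let (r , o , r∼b , al) = allowed-via-X Xa Mab in begin
        Ex a  ≡⟨ expansion-X Xa ⟩
        S a   ≡⟨ FactorComponents.factorComponent-closed GX fc al ⟩
        S r   ≡⟨ sym (expansion-D o r∼b) ⟩
        Ex b  ∎
        where open ≡-Reasoning
      ... | inj₂ Xa | inj₁ Xb = let (r , o , r∼a , al) = allowed-via-X Xb (IsMatching.symm isMatching a b Mab) in begin
        Ex a  ≡⟨ expansion-D o r∼a ⟩
        S r   ≡⟨ sym (FactorComponents.factorComponent-closed GX fc al) ⟩
        S b   ≡⟨ sym (expansion-X Xb) ⟩
        Ex b  ∎
        where open ≡-Reasoning
      ... | inj₂ Xa | inj₂ Xb =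
        expansion-∼ (∼-snoc (∼-refl (V∖X⁺ (E-Vˡ G Eab) Xa)) (V∖X⁺ (E-Vʳ G Eab) Xb) (E-adj G Eab))
        where
        Eab : E G a b ≡ true
        Eab = matching-E Mab

module Decomposition (G : Graph) (simple : SimpleGraph G) (pm : Factorizable G)
                     (X : VSet (n G)) (oddMaximal : OddMaximalBarrier G X) where

  X⊆V : X ⊆ V G
  X⊆V = proj₁ (proj₁ oddMaximal)

  barrier-tight : q G X ≡ count X
  barrier-tight = let (_ , d , deficiency , qX≡) = proj₁ oddMaximal in
    trans qX≡ (trans (cong (count X +_) (perfect⇒deficiency≡0 G pm d deficiency)) (NP.+-identityʳ _))

  open BarrierStructure G simple X
  open Matched barrier-tight pm
    using (contractedPerfectMatching; contractedMatching-X→oddRep; contractedMatching-oddRep→X)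
  open FactorComponents GX using (root; root-∈; factorComponent-V; factorComponent-closed; factorComponent-unique)

  expansions-cover : ∀ v → (X v ∨ DX G X v) ≡ true →
    Σ (VSet (n G)) λ S → IsDMComponent GX S × Expansion G X S v ≡ true
  expansions-cover v h with ∨-true⁻ {X v} h
  ... | inj₁ Xv = factorComponentOf GX v , fc , ∨-true⁺ˡ (∧-true⁺ (root-∈ fc) Xv)
    where
    fc : IsFactorComponent GX (factorComponentOf GX v)
    fc = factorComponentOf-isFactorComponent GX (GX-V-X (X⊆V v Xv) Xv)
  ... | inj₂ Dv = let (r , o , r∼v) = DX⁻ G X Dv ; fc = factorComponentOf-isFactorComponent GX (GX-V-oddRep o) in
    factorComponentOf GX r , fc , trans (Expansions.expansion-D (factorComponentOf GX r) o r∼v) (root-∈ fc)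

  expansions-disjoint : ∀ S S′ → IsDMComponent GX S → IsDMComponent GX S′ →
    ∀ v → Expansion G X S v ≡ true → Expansion G X S′ v ≡ true → ∀ w → S w ≡ S′ w
  expansions-disjoint S S′ fc fc′ v e e′ with true-or-false (X v)
  ... | inj₁ Xv = factorComponent-unique fc fc′
    (trans (sym (Expansions.expansion-X S Xv)) e) (trans (sym (Expansions.expansion-X S′ Xv)) e′)
  ... | inj₂ Xv =
    let (r , Sr , o , r∼v) = Expansions.expansion-witness S e Xv
        (r′ , S′r′ , o′ , r′∼v) = Expansions.expansion-witness S′ e′ Xv
    in factorComponent-unique fc fc′ Sr (subst (λ z → S′ z ≡ true) (oddRep-unique o′ o r′∼v r∼v) S′r′)

  module Component {S : VSet (n G)} (fc : IsDMComponent GX S) where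
    open Expansions S

    allowed-preserves-expansion : ∀ {a b} → Allowed G a b → Ex a ≡ Ex b
    allowed-preserves-expansion (pm′ , e) = Matched.matching-preserves-expansion barrier-tight pm′ fc e

    expansion-⊆-X∪D : Ex ⊆ (λ v → X v ∨ DX G X v)
    expansion-⊆-X∪D v e with true-or-false (X v)
    ... | inj₁ Xv = ∨-true⁺ˡ Xv
    ... | inj₂ Xv = let (r , _ , o , r∼v) = expansion-witness e Xv in
      ∨-true⁺ʳ {X v} (DX⁺ G X o r∼v)

    expansion-nonempty : NonEmpty Ex
    expansion-nonempty = root fc , Ex-root
      where
      Ex-root : Ex (root fc) ≡ true
      Ex-root with ∨-true⁻ {V G (root fc) ∧ X (root fc)} (factorComponent-V fc (root-∈ fc))
      ... | inj₁ VXr = trans (expansion-X (∧-true⁻ʳ {V G (root fc)} VXr)) (root-∈ fc)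
      ... | inj₂ o   = trans (expansion-oddRep o) (root-∈ fc)

    AReach-preserves-expansion : ∀ {u v} → AReach G u v → Ex u ≡ Ex v
    AReach-preserves-expansion (here _)    = refl
    AReach-preserves-expansion (step r al) = trans (AReach-preserves-expansion r) (allowed-preserves-expansion al)

    expansion-constant-on-factorComponent : ∀ {H} (fcH : IsFactorComponent G H) {v} → H v ≡ true →
      Ex (FactorComponents.root G fcH) ≡ Ex v
    expansion-constant-on-factorComponent fcH Hv =
      AReach-preserves-expansion (FactorComponents.AReach-root⁺ G fcH Hv)

    expansion-separating : Separating G Ex
    expansion-separating H fcH with true-or-false (Ex (FactorComponents.root G fcH))
    ... | inj₁ Ex-root = inj₁ (λ v Hv → trans (sym (expansion-constant-on-factorComponent fcH Hv)) Ex-root)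
    ... | inj₂ Ex-root = inj₂ (λ v Hv Exv →
      true≢false Exv (trans (sym (expansion-constant-on-factorComponent fcH Hv)) Ex-root))

    expansion-perfectMatching : PerfectMatching Ĝ
    expansion-perfectMatching = perfectMatching-induced G pm Ex (Matched.matching-preserves-expansion barrier-tight pm fc)

    X′ : VSet (n G)
    X′ v = X v ∧ Ex v

    module InducedX = Induced X X′ (λ v Xv → Xv) (λ v Exv → ∧-trueʳ Exv)

    module PX = Partner GX contractedPerfectMatching

    contracted-partner-S : ∀ {v} → V GX v ≡ true → S (PX.partner v) ≡ S v
    contracted-partner-S {v} Vv =
      sym (factorComponent-closed fc (contractedPerfectMatching , PX.partner-matched v Vv))

    contracted-partner-X→oddRep : ∀ {x} → X x ≡ true → oddRep G X (PX.partner x) ≡ true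
    contracted-partner-X→oddRep {x} Xx =
      contractedMatching-X→oddRep Xx (PX.partner-matched x (GX-V-X (X⊆V x Xx) Xx))

    contracted-partner-oddRep→X : ∀ {r} → oddRep G X r ≡ true → X (PX.partner r) ≡ true
    contracted-partner-oddRep→X {r} o = contractedMatching-oddRep→X o (PX.partner-matched r (GX-V-oddRep o))

    count-X∩S≡count-oddRep∩S : count (λ v → X v ∧ S v) ≡ count (λ r → oddRep G X r ∧ S r)
    count-X∩S≡count-oddRep∩S = NP.≤-antisym
      (count-≤-injection PX.partner X∩S→oddRep∩S
        (λ a b ha hb → PX.partner-injective a b (V-X∩S ha) (V-X∩S hb)))
      (count-≤-injection PX.partner oddRep∩S→X∩S
        (λ a b ha hb → PX.partner-injective a b (V-oddRep∩S ha) (V-oddRep∩S hb)))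
      where
      V-X∩S : ∀ {x} → (X x ∧ S x) ≡ true → V GX x ≡ true
      V-X∩S {x} h = GX-V-X (X⊆V x (∧-true⁻ˡ h)) (∧-true⁻ˡ h)
      V-oddRep∩S : ∀ {r} → (oddRep G X r ∧ S r) ≡ true → V GX r ≡ true
      V-oddRep∩S h = GX-V-oddRep (∧-true⁻ˡ h)
      X∩S→oddRep∩S : MapsTo (λ v → X v ∧ S v) (λ r → oddRep G X r ∧ S r) PX.partner
      X∩S→oddRep∩S x h = ∧-true⁺ (contracted-partner-X→oddRep (∧-true⁻ˡ h))
                                  (trans (contracted-partner-S (V-X∩S h)) (∧-true⁻ʳ {X x} h))
      oddRep∩S→X∩S : MapsTo (λ r → oddRep G X r ∧ S r) (λ v → X v ∧ S v) PX.partner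
      oddRep∩S→X∩S r h = ∧-true⁺ (contracted-partner-oddRep→X (∧-true⁻ˡ h))
                                  (trans (contracted-partner-S (V-oddRep∩S h)) (∧-true⁻ʳ {oddRep G X r} h))

    X′-tight : q Ĝ X′ ≡ count X′
    X′-tight = begin
      q Ĝ X′                                   ≡⟨ count-cong (λ r → sym (InducedX.oddRep-induced-∧ r)) ⟩
      count (λ r → oddRep G X r ∧ Ex r)        ≡⟨ count-cong (λ r → ∧-cong-true {oddRep G X r} expansion-oddRep) ⟩
      count (λ r → oddRep G X r ∧ S r)         ≡⟨ sym count-X∩S≡count-oddRep∩S ⟩
      count (λ v → X v ∧ S v)                  ≡⟨ count-cong (λ v → sym (∧-cong-true {X v} expansion-X)) ⟩
      count X′                                 ∎
      where open ≡-Reasoning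

    expansion-barrier : IsBarrier Ĝ X′
    expansion-barrier = (λ v h → ∧-true⁺ (X⊆V v (∧-true⁻ˡ h)) (∧-true⁻ʳ {X v} h)) ,
      0 , perfect⇒deficiency-0 Ĝ expansion-perfectMatching , trans X′-tight (sym (NP.+-identityʳ _))

    -- The odd components of G − X outside Ĝ are odd components of G − (X ∪ Y) as well, so a barrier
    -- X′ ∪ Y of Ĝ lifts to the barrier X ∪ Y of G.
    module Extension (Y : VSet (n G)) (Y⊆D : Y ⊆ DX Ĝ X′) where
      Y⊆Ex : Y ⊆ Ex
      Y⊆Ex v Yv = ∧-true⁻ʳ {V G v} (∧-true⁻ˡ (∧-true⁻ˡ (Y⊆D v Yv)))

      X∩Y=∅ : Disjoint X Y
      X∩Y=∅ v Xv Yv = true≢false (∧-true⁺ Xv (Y⊆Ex v Yv))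
        (not-true⁻ (∧-true⁻ʳ {V G v ∧ Ex v} (∧-true⁻ˡ (Y⊆D v Yv))))

      X′∩Y=∅ : Disjoint X′ Y
      X′∩Y=∅ v X′v = X∩Y=∅ v (∧-true⁻ˡ X′v)

      Y⊆DX : Y ⊆ DX G X
      Y⊆DX v Yv = InducedX.DX-induced (Y⊆D v Yv)

      Z Z′ : VSet (n G)
      Z v = X v ∨ Y v
      Z′ v = X′ v ∨ Y v

      module InducedZ = Induced Z Z′ (λ v → ∨-true⁺ˡ) (λ v Exv → cong (_∨ Y v) (∧-trueʳ Exv))

      oddOutside : ℕ
      oddOutside = count (λ r → oddRep G X r ∧ not (Ex r))

      count-X : count X′ + oddOutside ≡ count X
      count-X = begin
        count X′ + oddOutside                                   ≡⟨ cong (_+ oddOutside) (sym X′-tight) ⟩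
        q Ĝ X′ + oddOutside
          ≡⟨ cong (_+ oddOutside) (count-cong (λ r → sym (InducedX.oddRep-induced-∧ r))) ⟩
        count (λ r → oddRep G X r ∧ Ex r) + oddOutside          ≡⟨ sym (count-split (oddRep G X) Ex) ⟩
        q G X                                                   ≡⟨ barrier-tight ⟩
        count X                                                 ∎
        where open ≡-Reasoning

      q-Z : q Ĝ Z′ ≡ count Z′ → q G Z ≡ count Z
      q-Z qZ′ = begin
        q G Z                                                   ≡⟨ count-split (oddRep G Z) Ex ⟩
        count (λ r → oddRep G Z r ∧ Ex r) + count (λ r → oddRep G Z r ∧ not (Ex r))
          ≡⟨ cong₂ _+_ (count-cong InducedZ.oddRep-induced-∧)
                       (count-cong (λ r → ∧-not-cong-false (oddRep-∪-outside Y Y⊆Ex {r}))) ⟩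
        q Ĝ Z′ + oddOutside                                     ≡⟨ cong (_+ oddOutside) (trans qZ′ (count-∪ X′ Y X′∩Y=∅)) ⟩
        (count X′ + count Y) + oddOutside                       ≡⟨ xy∙z≈xz∙y (count X′) (count Y) oddOutside ⟩
        (count X′ + oddOutside) + count Y                       ≡⟨ cong (_+ count Y) count-X ⟩
        count X + count Y                                       ≡⟨ sym (count-∪ X Y X∩Y=∅) ⟩
        count Z                                                 ∎
        where open ≡-Reasoning

      barrier-lifts : IsBarrier Ĝ Z′ → IsBarrier G Z
      barrier-lifts (_ , d , deficiency , qZ′≡) =
        (λ v Zv → [ X⊆V v , (λ Yv → V∖X-V (∧-true⁻ˡ (Y⊆DX v Yv))) ]′ (∨-true⁻ {X v} Zv)) ,
        0 , perfect⇒deficiency-0 G pm ,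
        trans (q-Z (trans qZ′≡ (trans (cong (count Z′ +_) d≡0) (NP.+-identityʳ _)))) (sym (NP.+-identityʳ _))
        where
        d≡0 : d ≡ 0
        d≡0 = perfect⇒deficiency≡0 Ĝ expansion-perfectMatching d deficiency

    expansion-oddMaximal : OddMaximalBarrier Ĝ X′
    expansion-oddMaximal = expansion-barrier , λ Y Y⊆D nonempty barrier →
      proj₂ oddMaximal Y (Extension.Y⊆DX Y Y⊆D) nonempty (Extension.barrier-lifts Y Y⊆D barrier)

    contracted-V-Ex : ∀ {v} → V (Contract Ĝ X′) v ≡ true → Ex v ≡ true
    contracted-V-Ex {v} h = [ (λ VX′ → ∧-true⁻ʳ {V G v} (∧-true⁻ˡ VX′)) , InducedX.oddRep-induced-Ex ]′
                              (∨-true⁻ {(V G v ∧ Ex v) ∧ X′ v} h)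

    contracted-V : ∀ v → V (Contract Ĝ X′) v ≡ V (GX [ S ]) v
    contracted-V v = ≡-from-true⇔ to from
      where
      to : V (Contract Ĝ X′) v ≡ true → V (GX [ S ]) v ≡ true
      to h with ∨-true⁻ {(V G v ∧ Ex v) ∧ X′ v} h
      ... | inj₁ VX′ = let Xv = ∧-true⁻ˡ (∧-true⁻ʳ {V G v ∧ Ex v} VX′) in
        ∧-true⁺ (GX-V-X (∧-true⁻ˡ (∧-true⁻ˡ VX′)) Xv) (trans (sym (expansion-X Xv)) (contracted-V-Ex h))
      ... | inj₂ oĜ = let o = trans (sym (InducedX.oddRep-induced (contracted-V-Ex h))) oĜ in
        ∧-true⁺ (GX-V-oddRep o) (trans (sym (expansion-oddRep o)) (contracted-V-Ex h))
      from : V (GX [ S ]) v ≡ true → V (Contract Ĝ X′) v ≡ true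
      from h with ∨-true⁻ {V G v ∧ X v} (∧-true⁻ˡ h)
      ... | inj₁ VXv = let Xv = ∧-true⁻ʳ {V G v} VXv ; Exv = trans (expansion-X Xv) (∧-true⁻ʳ {V GX v} h) in
        ∨-true⁺ˡ (∧-true⁺ (∧-true⁺ (∧-true⁻ˡ {V G v} VXv) Exv) (∧-true⁺ Xv Exv))
      ... | inj₂ o = let Exv = trans (expansion-oddRep o) (∧-true⁻ʳ {V GX v} h) in
        ∨-true⁺ʳ {(V G v ∧ Ex v) ∧ X′ v} (trans (InducedX.oddRep-induced Exv) o)

    contractAdj-induced : ∀ {u r} → Ex u ≡ true → Ex r ≡ true → contractAdj Ĝ X′ u r ≡ contractAdj G X u r
    contractAdj-induced {u} {r} Exu Exr =
      cong₂ _∧_ (∧-trueʳ {V G u} Exu) (cong₂ _∧_ (∧-trueʳ {X u} Exu) (cong₂ _∧_ (InducedX.oddRep-induced Exr)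
        (anyV-cong (λ w → cong (_∧ adj G u w) (InducedX.conn-induced Exr w)))))

    contraction-iso : Iso (Contract Ĝ X′) (GX [ S ])
    contraction-iso = record
      { to = λ v → v ; from = λ v → v
      ; to-V = λ v h → trans (sym (contracted-V v)) h
      ; from-V = λ v h → trans (contracted-V v) h
      ; from-to = λ _ _ → refl ; to-from = λ _ _ → refl
      ; adj-pres = λ u v hu hv → let Exu = contracted-V-Ex hu ; Exv = contracted-V-Ex hv in
          cong₂ _∨_ (contractAdj-induced Exu Exv) (contractAdj-induced Exv Exu) }

proposition18 : (G : Graph) → SimpleGraph G → Factorizable G →
    (X : VSet (n G)) → OddMaximalBarrier G X →
    ((v : Fin (n G)) → (X v ∨ DX G X v) ≡ true →
       Σ (VSet (n G)) λ S → IsDMComponent (Contract G X) S × Expansion G X S v ≡ true)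
    × ((S S′ : VSet (n G)) → IsDMComponent (Contract G X) S → IsDMComponent (Contract G X) S′ →
       (v : Fin (n G)) → Expansion G X S v ≡ true → Expansion G X S′ v ≡ true →
       (w : Fin (n G)) → S w ≡ S′ w)
    × ((S : VSet (n G)) → IsDMComponent (Contract G X) S →
         (Expansion G X S ⊆ (λ v → X v ∨ DX G X v))
       × NonEmpty (Expansion G X S)
       × Separating G (Expansion G X S)
       × Factorizable (G [ Expansion G X S ])
       × OddMaximalBarrier (G [ Expansion G X S ]) (λ v → X v ∧ Expansion G X S v)
       × Iso (Contract (G [ Expansion G X S ]) (λ v → X v ∧ Expansion G X S v))
             (Contract G X [ S ]))
proposition18 G simple pm X oddMaximal =
  expansions-cover , expansions-disjoint , λ S fc → let open Component fc in
    expansion-⊆-X∪D , expansion-nonempty , expansion-separating ,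
    expansion-perfectMatching , expansion-oddMaximal , contraction-iso
  where open Decomposition G simple pm X oddMaximal
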